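{- Let $(M,\mathcal{C},\mathcal{C}^*)$ be an orthogonally oriented matroid on $E = X \,\dot\cup\, F \,\dot\cup\, G$ and let $N = M/F\setminus G$, a matroid on $X$. Let $\mathcal{C}_N$ be the set of signed subsets $C|_{\underline{C'}}$, where $\underline{C'}$ ranges over the circuits of $N$ and $C$ ranges over the elements of $\mathcal{C}$ with $\underline{C'} \subseteq \underline{C} \subseteq \underline{C'} \cup F$. Let $\mathcal{C}^*_N$ be the set of signed subsets $U|_{\underline{U'}}$, where $\underline{U'}$ ranges over the cocircuits of $N$ and $U$ ranges over the elements of $\mathcal{C}^*$ with $\underline{U'} \subseteq \underline{U} \subseteq \underline{U'} \cup G$. Then $(N,\mathcal{C}_N,\mathcal{C}^*_N)$ is an orthogonally oriented matroid on $X$; in particular $N$ is orthogonally orientable.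
   Context: Matroids are matroids in the sense of Bruhn, Diestel, Kriesell, Pendavingh and Wollan, on a possibly infinite ground set; cocircuits of $M$ are the circuits of the dual $M^*$, and minors $M/F\setminus G$ are defined as usual. A signed subset $X$ of $E$ is a subset $\underline{X}\subseteq E$ (its support) together with a partition $(X^+,X^-)$ of $\underline{X}$; write $X(e)=1$ if $e\in X^+$ and $X(e)=-1$ if $e\in X^-$. The opposite $-X$ has $(-X)^+=X^-$, $(-X)^-=X^+$. For $A\subseteq E$, the restriction $X|_A$ has $(X|_A)^+=X^+\cap A$, $(X|_A)^-=X^-\cap A$. Two signed subsets $X,Y$ are orthogonal if either $\underline{X}\cap\underline{Y}=\emptyset$ or there are $e,f\in\underline{X}\cap\underline{Y}$ with $X(e)Y(e)=-X(f)Y(f)$. A circuit signature of a matroid $M$ is a set $\mathcal{C}$ of signed subsets consisting of exactly two opposite signed subsets $C,-C$ with support $\underline{C}$ for each circuit $\underline{C}$ of $M$ (and nothing else); a cocircuit signature of $M$ is a circuit signature of $M^*$. A triple $(M,\mathcal{C},\mathcal{C}^*)$, with $\mathcal{C}$ a circuit signature and $\mathcal{C}^*$ a cocircuit signature of $M$, is an orthogonally oriented matroid if every element of $\mathcal{C}$ is orthogonal to every element of $\mathcal{C}^*$; $M$ is then called orthogonally orientable. (In the situation of the claim, $\mathcal{C}_N$ and $\mathcal{C}^*_N$ are known to be a circuit signature and a cocircuit signature of $N$, the induced signatures.) -}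

module Defs where

open import Level using (0ℓ)
open import Data.Empty using (⊥)
open import Data.Product using (Σ; ∃; _×_; _,_; proj₁)
open import Data.Sum using (_⊎_)
open import Relation.Nullary using (¬_)
open import Relation.Binary.PropositionalEquality using (_≡_)
open import Relation.Unary using (Pred; _⊆_; _≐_; _∪_; _∩_; ∁; ∅; _∈_)

Subset : Set → Set₁
Subset E = Pred E 0ℓ

sing : {E : Set} → E → Subset E
sing x = λ y → y ≡ x

Disj : {E : Set} → Subset E → Subset E → Set
Disj A B = ∀ e → A e → B e → ⊥

-- Matroids (Bruhn–Diestel–Kriesell–Pendavingh–Wollan) given by
-- independent sets, on a ground set `ground ⊆ E` (possibly infinite).

record MatroidData (E : Set) : Set₂ where
  field
    ground : Subset E
    indep  : Subset E → Set₁
open MatroidData public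

module _ {E : Set} (M : MatroidData E) where

  IsBase : Subset E → Set₁
  IsBase B = indep M B × (∀ (I : Subset E) → indep M I → B ⊆ I → I ⊆ B)

  record IsMatroid : Set₂ where
    field
      indep⊆ground : ∀ (I : Subset E) → indep M I → I ⊆ ground M
      I1 : indep M ∅
      I2 : ∀ (I J : Subset E) → indep M J → I ⊆ J → indep M I
      I3 : ∀ (I I′ : Subset E) → indep M I → ¬ IsBase I → IsBase I′ →
           ∃ λ x → I′ x × ¬ I x × indep M (I ∪ sing x)
      IM : ∀ (I X : Subset E) → indep M I → I ⊆ X → X ⊆ ground M →
           Σ (Subset E) λ J → (indep M J × I ⊆ J × J ⊆ X) ×
             (∀ (K : Subset E) → indep M K → I ⊆ K → K ⊆ X → J ⊆ K → K ⊆ J)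

  IsCircuit : Subset E → Set₁
  IsCircuit D = D ⊆ ground M × ¬ indep M D ×
                (∀ (D′ : Subset E) → D′ ⊆ D → ¬ indep M D′ → D ⊆ D′)

dual : {E : Set} → MatroidData E → MatroidData E
dual {E} M = record
  { ground = ground M
  ; indep  = λ I → I ⊆ ground M × Σ (Subset E) λ B → IsBase M B × Disj I B }

_∖ₘ_ : {E : Set} → MatroidData E → Subset E → MatroidData E
M ∖ₘ G = record
  { ground = ground M ∩ ∁ G
  ; indep  = λ I → indep M I × I ⊆ ∁ G }

_/ₘ_ : {E : Set} → MatroidData E → Subset E → MatroidData E
M /ₘ F = dual (dual M ∖ₘ F)

IsCocircuit : {E : Set} → MatroidData E → Subset E → Set₁
IsCocircuit M = IsCircuit (dual M)

record Signed (E : Set) : Set₁ where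
  field
    pos : Subset E
    neg : Subset E
    disjoint : Disj pos neg
open Signed public

supp : {E : Set} → Signed E → Subset E
supp X = pos X ∪ neg X

opp : {E : Set} → Signed E → Signed E
opp X = record { pos = neg X ; neg = pos X ; disjoint = λ e a b → disjoint X e b a }

restrict : {E : Set} → Signed E → Subset E → Signed E
restrict X A = record { pos = pos X ∩ A ; neg = neg X ∩ A
                      ; disjoint = λ e a b → disjoint X e (proj₁ a) (proj₁ b) }

_≈ₛ_ : {E : Set} → Signed E → Signed E → Set
X ≈ₛ Y = (pos X ≐ pos Y) × (neg X ≐ neg Y)

-- X(e)Y(e) = 1  resp.  X(e)Y(e) = -1
SameSign OppSign : {E : Set} → Signed E → Signed E → E → Set
SameSign X Y e = (pos X e × pos Y e) ⊎ (neg X e × neg Y e)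
OppSign  X Y e = (pos X e × neg Y e) ⊎ (neg X e × pos Y e)

Orthogonal : {E : Set} → Signed E → Signed E → Set
Orthogonal X Y = Disj (supp X) (supp Y) ⊎ ((∃ λ e → SameSign X Y e) × (∃ λ f → OppSign X Y f))

SignedFamily : Set → Set₂
SignedFamily E = Signed E → Set₁

IsCircuitSignature : {E : Set} → MatroidData E → SignedFamily E → Set₁
IsCircuitSignature {E} M 𝒞 =
  (∀ (X : Signed E) → 𝒞 X → IsCircuit M (supp X)) ×
  (∀ (D : Subset E) → IsCircuit M D →
     Σ (Signed E) λ C → supp C ≐ D × 𝒞 C × 𝒞 (opp C) ×
       (∀ (X : Signed E) → 𝒞 X → supp X ≐ D → X ≈ₛ C ⊎ X ≈ₛ opp C))

IsCocircuitSignature : {E : Set} → MatroidData E → SignedFamily E → Set₁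
IsCocircuitSignature M = IsCircuitSignature (dual M)

record IsOrthOrientedMatroid {E : Set} (M : MatroidData E)
                             (𝒞 𝒞* : SignedFamily E) : Set₂ where
  field
    matroid   : IsMatroid M
    circSig   : IsCircuitSignature M 𝒞
    cocircSig : IsCocircuitSignature M 𝒞*
    orth      : ∀ (C U : Signed E) → 𝒞 C → 𝒞* U → Orthogonal C U

minor : {E : Set} → MatroidData E → Subset E → Subset E → MatroidData E
minor M F G = (M /ₘ F) ∖ₘ G

inducedCircuits : {E : Set} → MatroidData E → SignedFamily E →
                  Subset E → Subset E → SignedFamily E
inducedCircuits {E} M 𝒞 F G Y =
  Σ (Subset E) λ D′ → IsCircuit (minor M F G) D′ ×
    Σ (Signed E) λ C → 𝒞 C × D′ ⊆ supp C × supp C ⊆ D′ ∪ F ×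
      Y ≈ₛ restrict C D′

inducedCocircuits : {E : Set} → MatroidData E → SignedFamily E →
                    Subset E → Subset E → SignedFamily E
inducedCocircuits {E} M 𝒞* F G Y =
  Σ (Subset E) λ U′ → IsCocircuit (minor M F G) U′ ×
    Σ (Signed E) λ U → 𝒞* U × U′ ⊆ supp U × supp U ⊆ U′ ∪ G ×
      Y ≈ₛ restrict U U′

IsPartition3 : {E : Set} → Subset E → Subset E → Subset E → Subset E → Set
IsPartition3 S X F G =
  (S ≐ (X ∪ F) ∪ G) × Disj X F × Disj X G × Disj F G

-- A circuit D′ of N = M/F∖G lifts to a circuit D of M with
-- D′ ⊆ D ⊆ D′ ∪ F: the fundamental circuit of e ∈ D′ over (D′ − e) ∪ B, for a
-- basis B of F. Since N* = M*/G∖F, a cocircuit U′ of N likewise lifts to a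
-- cocircuit of M inside U′ ∪ G. Lifts of a circuit and of a cocircuit of N meet
-- only in D′ ∩ U′, so restricting signed lifts preserves orthogonality. The two
-- signings of a lift of D′ restrict to two opposite signings of D′ that do not
-- depend on the lift: for e ≠ f in D′ some cocircuit of N meets D′ exactly in
-- {e, f}, and orthogonality to a signed lift of it determines the relative sign
-- of two lifts at f from the one at e. Excluded middle is used throughout, since
-- the ground set may be infinite.
module Submission where

open import Defs
open import Level using (0ℓ; suc; Lift; lift; lower)
open import Axiom.ExcludedMiddle using (ExcludedMiddle)
open import Axiom.DoubleNegationElimination using (DoubleNegationElimination; em⇒dne)
open import Data.Empty using (⊥-elim)
open import Data.Product using (Σ; ∃; _×_; _,_; proj₁; proj₂)
open import Data.Sum using (_⊎_; inj₁; inj₂; [_,_]′)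
import Data.Sum as Sum
import Data.Product as Product
open import Function using (case_of_)
open import Relation.Nullary using (¬_; yes; no)
open import Relation.Nullary.Decidable using (True; toWitness; fromWitness; map′)
open import Relation.Binary.PropositionalEquality using (_≡_; refl; sym; trans; subst)
open import Relation.Unary using (_⊆_; _≐_; _∪_; _∩_; ∁)
open import Relation.Unary.Properties using (≐-refl; ≐-sym; ≐-trans)

module _ {E : Set} where

  infixl 7 _─_
  _─_ : Subset E → E → Subset E
  (A ─ x) y = A y × ¬ y ≡ x

  IsBasis : MatroidData E → Subset E → Subset E → Set₁
  IsBasis M X J = indep M J × J ⊆ X ×
    (∀ (K : Subset E) → indep M K → J ⊆ K → K ⊆ X → K ⊆ J)

  infix 4 _≅_
  _≅_ : MatroidData E → MatroidData E → Set₁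
  M₁ ≅ M₂ = ground M₁ ≐ ground M₂ ×
            (∀ (I : Subset E) → indep M₁ I → indep M₂ I) ×
            (∀ (I : Subset E) → indep M₂ I → indep M₁ I)

  ≅-sym : {M₁ M₂ : MatroidData E} → M₁ ≅ M₂ → M₂ ≅ M₁
  ≅-sym ((g₁ , g₂) , to , from) = (g₂ , g₁) , from , to

  ≅-isCircuit : {M₁ M₂ : MatroidData E} → M₁ ≅ M₂ → {D : Subset E} → IsCircuit M₁ D → IsCircuit M₂ D
  ≅-isCircuit ((g₁ , _) , to , from) (D⊆g , ¬iD , minimal) =
    (λ p → g₁ (D⊆g p)) , (λ iD → ¬iD (from _ iD)) , λ D′ D′⊆D ¬iD′ → minimal D′ D′⊆D (λ iD′ → ¬iD′ (to _ iD′))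

  LiftOf : Subset E → Subset E → Subset E → Set
  LiftOf F D′ D = D′ ⊆ D × D ⊆ D′ ∪ F

  minor-ground : (M : MatroidData E) {X F G : Subset E} → IsPartition3 (ground M) X F G →
                 ground (minor M F G) ≐ X
  minor-ground _ ((g⊆XFG , XFG⊆g) , X∩F , X∩G , _) =
    (λ { ((gx , ¬Fx) , ¬Gx) → case g⊆XFG gx of λ
           { (inj₁ (inj₁ Xx)) → Xx ; (inj₁ (inj₂ Fx)) → ⊥-elim (¬Fx Fx) ; (inj₂ Gx) → ⊥-elim (¬Gx Gx) } }) ,
    λ {x} Xx → (XFG⊆g (inj₁ (inj₁ Xx)) , X∩F x Xx) , X∩G x Xx

  lifts-meet-inside : {F G D′ U′ D U : Subset E} → Disj F G → D′ ⊆ ∁ G → U′ ⊆ ∁ F →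
                      LiftOf F D′ D → LiftOf G U′ U → ∀ {x} → D x → U x → D′ x × U′ x
  lifts-meet-inside F∩G D′∩G U′∩F (_ , D⊆D′∪F) (_ , U⊆U′∪G) {x} Dx Ux
    with D⊆D′∪F Dx | U⊆U′∪G Ux
  ... | inj₁ D′x | inj₁ U′x = D′x , U′x
  ... | inj₁ D′x | inj₂ Gx  = ⊥-elim (D′∩G D′x Gx)
  ... | inj₂ Fx  | inj₁ U′x = ⊥-elim (U′∩F U′x Fx)
  ... | inj₂ Fx  | inj₂ Gx  = ⊥-elim (F∩G x Fx Gx)

module _ {E : Set} where

  LiftOf-opp : (C : Signed E) {F D′ : Subset E} → LiftOf F D′ (supp C) → LiftOf F D′ (supp (opp C))
  LiftOf-opp _ (D′⊆C , C⊆D′∪F) = (λ p → Sum.swap (D′⊆C p)) , λ p → C⊆D′∪F (Sum.swap p)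

  ≈ₛ-refl : (Y : Signed E) → Y ≈ₛ Y
  ≈ₛ-refl _ = ≐-refl , ≐-refl

  ≈ₛ-trans : (Y Z W : Signed E) → Y ≈ₛ Z → Z ≈ₛ W → Y ≈ₛ W
  ≈ₛ-trans _ _ _ (p , n) (p′ , n′) = ≐-trans p p′ , ≐-trans n n′

  supp-resp-≈ₛ : (Y Z : Signed E) → Y ≈ₛ Z → supp Y ≐ supp Z
  supp-resp-≈ₛ _ _ ((p⊆ , p⊇) , (n⊆ , n⊇)) = Sum.map p⊆ n⊆ , Sum.map p⊇ n⊇

  supp-restrict : (C : Signed E) {A : Subset E} → A ⊆ supp C → supp (restrict C A) ≐ A
  supp-restrict _ A⊆C = [ proj₂ , proj₂ ]′ , λ Ax → Sum.map (_, Ax) (_, Ax) (A⊆C Ax)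

  restrict-cong : (C : Signed E) {A B : Subset E} → A ≐ B → restrict C A ≈ₛ restrict C B
  restrict-cong _ (A⊆B , B⊆A) = (Product.map₂ A⊆B , Product.map₂ B⊆A) , (Product.map₂ A⊆B , Product.map₂ B⊆A)

  sign-cases : (Z Y : Signed E) {x : E} → supp Z x → supp Y x → SameSign Z Y x ⊎ OppSign Z Y x
  sign-cases _ _ (inj₁ a) (inj₁ b) = inj₁ (inj₁ (a , b))
  sign-cases _ _ (inj₁ a) (inj₂ b) = inj₂ (inj₁ (a , b))
  sign-cases _ _ (inj₂ a) (inj₁ b) = inj₂ (inj₂ (a , b))
  sign-cases _ _ (inj₂ a) (inj₂ b) = inj₁ (inj₂ (a , b))

  SameSign-sym : (Z Y : Signed E) {x : E} → SameSign Z Y x → SameSign Y Z x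
  SameSign-sym _ _ = Sum.map Product.swap Product.swap

  SameSign-trans : (Z Y W : Signed E) {x : E} → SameSign Z Y x → SameSign Y W x → SameSign Z W x
  SameSign-trans _ _ _ (inj₁ (a , _)) (inj₁ (_ , d)) = inj₁ (a , d)
  SameSign-trans _ Y _ {x} (inj₁ (_ , b)) (inj₂ (c , _)) = ⊥-elim (disjoint Y x b c)
  SameSign-trans _ Y _ {x} (inj₂ (_ , b)) (inj₁ (c , _)) = ⊥-elim (disjoint Y x c b)
  SameSign-trans _ _ _ (inj₂ (a , _)) (inj₂ (_ , d)) = inj₂ (a , d)

  SameSign-via : (Z Y W : Signed E) {x : E} → SameSign Z W x → SameSign Y W x → SameSign Z Y x
  SameSign-via Z Y W s t = SameSign-trans Z W Y s (SameSign-sym Y W t)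

  SameSign⇒¬OppSign : (Z Y : Signed E) {x : E} → SameSign Z Y x → ¬ OppSign Z Y x
  SameSign⇒¬OppSign _ Y {x} (inj₁ (_ , b)) (inj₁ (_ , d)) = disjoint Y x b d
  SameSign⇒¬OppSign Z _ {x} (inj₁ (a , _)) (inj₂ (c , _)) = disjoint Z x a c
  SameSign⇒¬OppSign Z _ {x} (inj₂ (a , _)) (inj₁ (c , _)) = disjoint Z x c a
  SameSign⇒¬OppSign _ Y {x} (inj₂ (_ , b)) (inj₂ (_ , d)) = disjoint Y x d b

  SameSign⇒supp : (Z Y : Signed E) {x : E} → SameSign Z Y x → supp Z x × supp Y x
  SameSign⇒supp _ _ (inj₁ (a , b)) = inj₁ a , inj₁ b
  SameSign⇒supp _ _ (inj₂ (a , b)) = inj₂ a , inj₂ b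

  OppSign⇒supp : (Z Y : Signed E) {x : E} → OppSign Z Y x → supp Z x × supp Y x
  OppSign⇒supp _ _ (inj₁ (a , b)) = inj₁ a , inj₂ b
  OppSign⇒supp _ _ (inj₂ (a , b)) = inj₂ a , inj₁ b

  Orthogonal-sym : (Z Y : Signed E) → Orthogonal Z Y → Orthogonal Y Z
  Orthogonal-sym _ _ (inj₁ Z∩Y) = inj₁ λ e p q → Z∩Y e q p
  Orthogonal-sym Z Y (inj₂ ((a , s) , (b , o))) =
    inj₂ ((a , SameSign-sym Z Y s) , (b , Sum.swap (Sum.map Product.swap Product.swap o)))

  orthogonal-flip : (C W : Signed E) {e f : E} → Orthogonal C W →
                    (∀ {x} → supp C x → supp W x → x ≡ e ⊎ x ≡ f) →
                    SameSign C W e → OppSign C W f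
  orthogonal-flip C W (inj₁ C∩W) _ s = ⊥-elim (Product.uncurry (C∩W _) (SameSign⇒supp C W s))
  orthogonal-flip C W (inj₂ (_ , (b , o))) meet s with Product.uncurry meet (OppSign⇒supp C W o)
  ... | inj₁ refl = ⊥-elim (SameSign⇒¬OppSign C W s o)
  ... | inj₂ refl = o

  restrict-SameSign : (C₁ C₂ : Signed E) {A : Subset E} → (∀ {x} → A x → SameSign C₁ C₂ x) →
                      restrict C₁ A ≈ₛ restrict C₂ A
  restrict-SameSign C₁ C₂ same =
    ((λ (p , Ax) → pos⇒pos C₁ C₂ (same Ax) p , Ax) , (λ (p , Ax) → pos⇒pos C₂ C₁ (SameSign-sym C₁ C₂ (same Ax)) p , Ax)) ,
    ((λ (n , Ax) → neg⇒neg C₁ C₂ (same Ax) n , Ax) , (λ (n , Ax) → neg⇒neg C₂ C₁ (SameSign-sym C₁ C₂ (same Ax)) n , Ax))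
    where
    pos⇒pos : (Z Y : Signed E) {x : E} → SameSign Z Y x → pos Z x → pos Y x
    pos⇒pos _ _ (inj₁ (_ , b)) _ = b
    pos⇒pos Z _ {x} (inj₂ (a , _)) p = ⊥-elim (disjoint Z x p a)
    neg⇒neg : (Z Y : Signed E) {x : E} → SameSign Z Y x → neg Z x → neg Y x
    neg⇒neg Z _ {x} (inj₁ (a , _)) n = ⊥-elim (disjoint Z x a n)
    neg⇒neg _ _ (inj₂ (_ , b)) _ = b

  -- OppSign C₁ C₂ x is definitionally SameSign C₁ (opp C₂) x, and restriction
  -- commutes with opp on the nose.
  restrict-OppSign : (C₁ C₂ : Signed E) {A : Subset E} → (∀ {x} → A x → OppSign C₁ C₂ x) →
                     restrict C₁ A ≈ₛ opp (restrict C₂ A)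
  restrict-OppSign C₁ C₂ = restrict-SameSign C₁ (opp C₂)

  ≈ₛ-restrict-orthogonal : (Y C Z W : Signed E) {A B : Subset E} →
    Y ≈ₛ restrict C A → Z ≈ₛ restrict W B → (∀ {x} → supp C x → supp W x → A x × B x) →
    Orthogonal C W → Orthogonal Y Z
  ≈ₛ-restrict-orthogonal Y C Z W {A} {B} Y≈ Z≈ meet (inj₁ C∩W) =
    inj₁ λ e Ye Ze → C∩W e (Sum.map proj₁ proj₁ (proj₁ (supp-resp-≈ₛ Y (restrict C A) Y≈) Ye))
                         (Sum.map proj₁ proj₁ (proj₁ (supp-resp-≈ₛ Z (restrict W B) Z≈) Ze))
  ≈ₛ-restrict-orthogonal Y C Z W {A} {B} ((_ , pY) , (_ , nY)) ((_ , pZ) , (_ , nZ)) meet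
                         (inj₂ ((a , s) , (b , o))) =
    inj₂ ((a , same s (Product.uncurry meet (SameSign⇒supp C W s))) ,
          (b , opposite o (Product.uncurry meet (OppSign⇒supp C W o))))
    where
    same : ∀ {x} → SameSign C W x → A x × B x → SameSign Y Z x
    same (inj₁ (c , w)) (Ax , Bx) = inj₁ (pY (c , Ax) , pZ (w , Bx))
    same (inj₂ (c , w)) (Ax , Bx) = inj₂ (nY (c , Ax) , nZ (w , Bx))
    opposite : ∀ {x} → OppSign C W x → A x × B x → OppSign Y Z x
    opposite (inj₁ (c , w)) (Ax , Bx) = inj₁ (pY (c , Ax) , nZ (w , Bx))
    opposite (inj₂ (c , w)) (Ax , Bx) = inj₂ (nY (c , Ax) , pZ (w , Bx))

  signature-transport : {M₁ M₂ : MatroidData E} {𝒜₁ 𝒜₂ : SignedFamily E} → M₁ ≅ M₂ → 𝒜₁ ≐ 𝒜₂ →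
                        IsCircuitSignature M₁ 𝒜₁ → IsCircuitSignature M₂ 𝒜₂
  signature-transport M₁≅M₂ (𝒜₁⊆𝒜₂ , 𝒜₂⊆𝒜₁) (supports , signings) =
    (λ X 𝒜X → ≅-isCircuit M₁≅M₂ (supports X (𝒜₂⊆𝒜₁ 𝒜X))) ,
    λ D cD → let (C , C≐D , 𝒜C , 𝒜C⁻ , unique) = signings D (≅-isCircuit (≅-sym M₁≅M₂) cD)
             in C , C≐D , 𝒜₁⊆𝒜₂ 𝒜C , 𝒜₁⊆𝒜₂ 𝒜C⁻ , λ X 𝒜X → unique X (𝒜₂⊆𝒜₁ 𝒜X)

module Classical (lem : ExcludedMiddle (suc 0ℓ)) where

  em : ExcludedMiddle 0ℓ
  em {P} = map′ lower lift (lem {Lift (suc 0ℓ) P})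

  dne : DoubleNegationElimination 0ℓ
  dne = em⇒dne em

  em₁ : ExcludedMiddle (suc 0ℓ)
  em₁ = lem

  dne₁ : DoubleNegationElimination (suc 0ℓ)
  dne₁ = em⇒dne em₁

  -- Squashes a proposition of Set₁ into Set, so that it can occur in the
  -- definition of a subset.
  Holds : Set₁ → Set
  Holds P = True (lem {P})

  module _ {E : Set} where

    ⊈⇒∃ : {A B : Subset E} → ¬ (A ⊆ B) → ∃ λ x → A x × ¬ B x
    ⊈⇒∃ A⊈B = dne λ ∄ → A⊈B λ {x} Ax → dne λ ¬Bx → ∄ (x , Ax , ¬Bx)

    circuit-minus-indep : {M : MatroidData E} {C : Subset E} {x : E} →
                          IsCircuit M C → C x → indep M (C ─ x)
    circuit-minus-indep (_ , _ , minimal) Cx =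
      dne₁ λ dep → proj₂ (minimal _ proj₁ dep Cx) refl

    module MatroidLemmas {M : MatroidData E} (mat : IsMatroid M) where
      open IsMatroid mat

      indep-mono : {I J : Subset E} → indep M J → I ⊆ J → indep M I
      indep-mono = I2 _ _

      basis-extend : {I X : Subset E} → indep M I → I ⊆ X → X ⊆ ground M →
                     Σ (Subset E) λ J → I ⊆ J × IsBasis M X J
      basis-extend {I} {X} iI I⊆X X⊆g with IM I X iI I⊆X X⊆g
      ... | J , (iJ , I⊆J , J⊆X) , maximal =
        J , I⊆J , iJ , J⊆X , λ K iK J⊆K K⊆X → maximal K iK (λ p → J⊆K (I⊆J p)) K⊆X J⊆K

      basis-of-∅ : {X : Subset E} → X ⊆ ground M → Σ (Subset E) (IsBasis M X)
      basis-of-∅ X⊆g with basis-extend I1 (λ ()) X⊆g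
      ... | J , _ , basis = J , basis

      base-extend : {I : Subset E} → indep M I → Σ (Subset E) λ B → IsBase M B × I ⊆ B
      base-extend iI with basis-extend iI (indep⊆ground _ iI) (λ p → p)
      ... | B , I⊆B , (iB , _ , maximal) =
        B , (iB , λ K iK B⊆K → maximal K iK B⊆K (indep⊆ground K iK)) , I⊆B

      base-minus-¬isBase : {B : Subset E} {b : E} → indep M B → B b → ¬ IsBase M (B ─ b)
      base-minus-¬isBase iB Bb (_ , maximal) = proj₂ (maximal _ iB proj₁ Bb) refl

      ⊂-¬isBasis : {X K T : Subset E} → indep M K → K ⊆ X → T ⊆ K → ¬ (K ⊆ T) →
                   ¬ IsBasis M X T
      ⊂-¬isBasis iK K⊆X T⊆K K⊈T (_ , _ , maximal) = K⊈T (maximal _ iK T⊆K K⊆X)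

      basis-of-⊇base-isBase : {B S J : Subset E} → IsBase M B → B ⊆ S → IsBasis M S J →
                              IsBase M J
      basis-of-⊇base-isBase {J = J} bB B⊆S (iJ , J⊆S , maximal) = dne₁ λ ¬base →
        let (x , Bx , ¬Jx , iJx) = I3 J _ iJ ¬base bB
        in ¬Jx (maximal (J ∪ sing x) iJx inj₁
                  (λ { (inj₁ p) → J⊆S p ; (inj₂ refl) → B⊆S Bx }) (inj₂ refl))

      ¬isBasis-augment : {X I : Subset E} → indep M I → I ⊆ X → ¬ IsBasis M X I →
                         ∃ λ y → X y × ¬ I y × indep M (I ∪ sing y)
      ¬isBasis-augment iI I⊆X ¬basis = dne₁ λ ∄ → ¬basis (iI , I⊆X , λ K iK I⊆K K⊆X {k} Kk →
        dne λ ¬Ik → ∄ (k , K⊆X Kk , ¬Ik ,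
          indep-mono iK (λ { (inj₁ p) → I⊆K p ; (inj₂ refl) → Kk })))

      basis-∪-outside-isBase : {X B B′ : Subset E} → IsBasis M X B → IsBase M B′ →
                               indep M (B ∪ (B′ ∩ ∁ X)) → IsBase M (B ∪ (B′ ∩ ∁ X))
      basis-∪-outside-isBase {X} {B} (_ , B⊆X , maximal) bB′ iK = dne₁ λ ¬base →
        let (x , B′x , ¬Kx , iKx) = I3 _ _ iK ¬base bB′
        in case em {X x} of λ
          { (yes Xx) → ¬Kx (inj₁ (maximal (B ∪ sing x)
                (indep-mono iKx λ { (inj₁ p) → inj₁ (inj₁ p) ; (inj₂ q) → inj₂ q })
                inj₁ (λ { (inj₁ p) → B⊆X p ; (inj₂ refl) → Xx }) (inj₂ refl)))
          ; (no ¬Xx) → ¬Kx (inj₂ (B′x , ¬Xx)) }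

      -- Extend I + y to a base B′ inside (I + y) ∪ B̂ for a base B̂ ⊇ B; then
      -- B ∪ (B′ ∖ X) is a base, and exchanging B′ − y against it yields the
      -- required element of B.
      basis-augment : {X B I : Subset E} → X ⊆ ground M → IsBasis M X B →
                      indep M I → I ⊆ X → ¬ IsBasis M X I →
                      ∃ λ x → B x × ¬ I x × indep M (I ∪ sing x)
      basis-augment {X} {B} {I} X⊆g bB@(iB , _ , _) iI I⊆X ¬basis =
        let (y , Xy , ¬Iy , iIy) = ¬isBasis-augment iI I⊆X ¬basis
            (B̂ , bB̂ , B⊆B̂) = base-extend iB
            S⊆g : ((I ∪ sing y) ∪ B̂) ⊆ ground M
            S⊆g = λ { (inj₁ p) → indep⊆ground _ iIy p ; (inj₂ p) → indep⊆ground _ (proj₁ bB̂) p }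
            (B′ , Iy⊆B′ , basisB′@(iB′ , B′⊆S , _)) = basis-extend iIy inj₁ S⊆g
            K⊆B̂ : B ∪ (B′ ∩ ∁ X) ⊆ B̂
            K⊆B̂ = λ { (inj₁ p) → B⊆B̂ p
                    ; (inj₂ (p , ¬Xp)) → case B′⊆S p of λ
                        { (inj₁ (inj₁ Ip)) → ⊥-elim (¬Xp (I⊆X Ip))
                        ; (inj₁ (inj₂ refl)) → ⊥-elim (¬Xp Xy)
                        ; (inj₂ q) → q } }
            bK = basis-∪-outside-isBase bB (basis-of-⊇base-isBase bB̂ inj₂ basisB′)
                   (indep-mono (proj₁ bB̂) K⊆B̂)
            B′y = Iy⊆B′ (inj₂ refl)
            (x , Kx , ¬x∈B′-y , iB′-y+x) =
              I3 (B′ ─ y) _ (indep-mono iB′ proj₁) (base-minus-¬isBase iB′ B′y) bK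
            Bx : B x
            Bx = case Kx of λ
              { (inj₁ p) → p
              ; (inj₂ (B′x , ¬Xx)) →
                  ⊥-elim (¬Xx (subst X (sym (dne λ x≢y → ¬x∈B′-y (B′x , x≢y))) Xy)) }
            I⊆B′-y : I ⊆ B′ ─ y
            I⊆B′-y = λ Iz → Iy⊆B′ (inj₁ Iz) , λ { refl → ¬Iy Iz }
        in x , Bx , (λ Ix → ¬x∈B′-y (I⊆B′-y Ix)) ,
           indep-mono iB′-y+x (λ { (inj₁ p) → inj₁ (I⊆B′-y p) ; (inj₂ q) → inj₂ q })

      ∪-basis-indep-swap : {F B₁ B₂ I : Subset E} → F ⊆ ground M →
                           IsBasis M F B₁ → IsBasis M F B₂ → Disj I F →
                           indep M (I ∪ B₁) → indep M (I ∪ B₂)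
      ∪-basis-indep-swap {F} {B₁} {B₂} {I} F⊆g (iB₁ , B₁⊆F , maximal₁) (iB₂ , B₂⊆F , _) I∩F iIB₁ =
        dne₁ λ ¬iIB₂ →
          let Y⊆g : (I ∪ F) ⊆ ground M
              Y⊆g = λ { (inj₁ p) → indep⊆ground _ iIB₁ (inj₁ p) ; (inj₂ p) → F⊆g p }
              (J , B₂⊆J , bJ@(iJ , J⊆Y , _)) = basis-extend iB₂ (λ p → inj₂ (B₂⊆F p)) Y⊆g
              (i , Ii , ¬Ji) = ⊈⇒∃ {A = I} {B = J} λ I⊆J →
                ¬iIB₂ (indep-mono iJ λ { (inj₁ p) → I⊆J p ; (inj₂ q) → B₂⊆J q })
              K⊆IB₁ : ((I ─ i) ∪ B₁) ⊆ I ∪ B₁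
              K⊆IB₁ = λ { (inj₁ (p , _)) → inj₁ p ; (inj₂ q) → inj₂ q }
              ¬basisK = ⊂-¬isBasis iIB₁ (λ { (inj₁ p) → inj₁ p ; (inj₂ q) → inj₂ (B₁⊆F q) }) K⊆IB₁
                (λ IB₁⊆K → case IB₁⊆K (inj₁ Ii) of λ
                   { (inj₁ (_ , i≢i)) → i≢i refl ; (inj₂ q) → I∩F i Ii (B₁⊆F q) })
              (x , Jx , ¬Kx , iKx) = basis-augment Y⊆g bJ (indep-mono iIB₁ K⊆IB₁)
                (λ { (inj₁ (p , _)) → inj₁ p ; (inj₂ q) → inj₂ (B₁⊆F q) }) ¬basisK
          in case J⊆Y Jx of λ
            { (inj₁ Ix) → case em {x ≡ i} of λ
                { (yes x≡i) → ¬Ji (subst J x≡i Jx)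
                ; (no x≢i) → ¬Kx (inj₁ (Ix , x≢i)) }
            ; (inj₂ Fx) → ¬Kx (inj₂ (maximal₁ (B₁ ∪ sing x)
                (indep-mono iKx λ { (inj₁ p) → inj₁ (inj₂ p) ; (inj₂ q) → inj₂ q })
                inj₁ (λ { (inj₁ p) → B₁⊆F p ; (inj₂ refl) → Fx }) (inj₂ refl))) }

      fundamentalCircuit : Subset E → E → Subset E
      fundamentalCircuit T e y = y ≡ e ⊎ (T y × Holds (indep M ((T ─ y) ∪ sing e)))

      fundamentalCircuit-dependent : {T : Subset E} {e : E} → indep M T → ground M e →
        ¬ indep M (T ∪ sing e) → ¬ indep M (fundamentalCircuit T e)
      fundamentalCircuit-dependent {T} {e} iT ge ¬iTe iD =
        let Y⊆g : (T ∪ sing e) ⊆ ground M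
            Y⊆g = λ { (inj₁ p) → indep⊆ground _ iT p ; (inj₂ refl) → ge }
            (J , D⊆J , bJ@(iJ , J⊆Y , _)) = basis-extend iD
              (λ { (inj₁ refl) → inj₂ refl ; (inj₂ (p , _)) → inj₁ p }) Y⊆g
            (y , Yy , ¬Jy) = ⊈⇒∃ {A = T ∪ sing e} {B = J} λ Y⊆J → ¬iTe (indep-mono iJ Y⊆J)
            Ty : T y
            Ty = case Yy of λ { (inj₁ p) → p ; (inj₂ y≡e) → ⊥-elim (¬Jy (D⊆J (inj₁ y≡e))) }
            ¬basis = ⊂-¬isBasis iT inj₁ proj₁ (λ T⊆T-y → proj₂ (T⊆T-y Ty) refl)
            (x , Jx , ¬x∈T-y , iT-y+x) = basis-augment Y⊆g bJ (indep-mono iT proj₁)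
              (λ p → inj₁ (proj₁ p)) ¬basis
        in case J⊆Y Jx of λ
          { (inj₁ Tx) → case em {x ≡ y} of λ
              { (yes x≡y) → ¬Jy (subst J x≡y Jx)
              ; (no x≢y) → ¬x∈T-y (Tx , x≢y) }
          ; (inj₂ x≡e) → ¬Jy (D⊆J (inj₂ (Ty , fromWitness
              (subst (λ w → indep M ((T ─ y) ∪ sing w)) x≡e iT-y+x)))) }

      fundamentalCircuit-isCircuit : {T : Subset E} {e : E} → indep M T → ¬ T e → ground M e →
        ¬ indep M (T ∪ sing e) → IsCircuit M (fundamentalCircuit T e)
      fundamentalCircuit-isCircuit {T} {e} iT ¬Te ge ¬iTe =
        D⊆g , fundamentalCircuit-dependent iT ge ¬iTe , minimal
        where
        D⊆g : fundamentalCircuit T e ⊆ ground M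
        D⊆g (inj₁ refl) = ge
        D⊆g (inj₂ (p , _)) = indep⊆ground _ iT p
        minimal : ∀ (D′ : Subset E) → D′ ⊆ fundamentalCircuit T e → ¬ indep M D′ →
                  fundamentalCircuit T e ⊆ D′
        minimal D′ D′⊆D ¬iD′ {d} Dd = dne λ ¬D′d → ¬iD′ (case Dd of λ
          { (inj₁ refl) → indep-mono iT λ p → case D′⊆D p of λ
               { (inj₁ refl) → ⊥-elim (¬D′d p) ; (inj₂ (q , _)) → q }
          ; (inj₂ (_ , t)) → indep-mono (toWitness t) λ p → case D′⊆D p of λ
               { (inj₁ refl) → inj₂ refl
               ; (inj₂ (q , _)) → inj₁ (q , λ { refl → ¬D′d p }) } })

      complement-isDualBase : {B : Subset E} → IsBase M B → IsBase (dual M) (ground M ∩ ∁ B)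
      complement-isDualBase {B} bB = (proj₁ , B , bB , λ _ p q → proj₂ p q) , λ K iK sub {k} Kk →
        let (K⊆g , D , bD , K∩D) = iK
            D⊆B : D ⊆ B
            D⊆B = λ {d} Dd → dne λ ¬Bd → K∩D d (sub (indep⊆ground _ (proj₁ bD) Dd , ¬Bd)) Dd
        in K⊆g Kk , λ Bk → K∩D k Kk (proj₂ bD B (proj₁ bB) D⊆B Bk)

      dualBase-complement : {B* : Subset E} → IsBase (dual M) B* →
        Σ (Subset E) λ B → IsBase M B × Disj B* B × (ground M ∩ ∁ B ⊆ B*)
      dualBase-complement ((B*⊆g , B , bB , B*∩B) , maximal) =
        B , bB , B*∩B , maximal (ground M ∩ ∁ B) (proj₁ , B , bB , λ _ p q → proj₂ p q)
                          (λ p → B*⊆g p , λ q → B*∩B _ p q)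

      indep-⊇exchange-isBase : {B D : Subset E} {b u : E} → IsBase M B → indep M D →
        B ─ b ⊆ D → D u → ¬ (B ─ b) u → IsBase M D
      indep-⊇exchange-isBase {B} {D} {b} {u} bB@(_ , maximalB) iD B-b⊆D Du ¬u∈B-b = dne₁ λ ¬base →
        let (x , Bx , ¬Dx , iDx) = I3 D B iD ¬base bB
        in case em {x ≡ b} of λ
          { (yes x≡b) →
              let B⊆D+x : B ⊆ D ∪ sing x
                  B⊆D+x = λ {z} Bz → case em {z ≡ b} of λ
                    { (yes z≡b) → inj₂ (trans z≡b (sym x≡b))
                    ; (no z≢b) → inj₁ (B-b⊆D (Bz , z≢b)) }
                  u≡b = dne λ u≢b → ¬u∈B-b (maximalB _ iDx B⊆D+x (inj₁ Du) , u≢b)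
              in ¬Dx (subst D (trans u≡b (sym x≡b)) Du)
          ; (no x≢b) → ¬Dx (B-b⊆D (Bx , x≢b)) }

      fundamentalCocircuit : Subset E → E → Subset E
      fundamentalCocircuit B b x = ground M x × ¬ (B ─ b) x × Holds (indep M ((B ─ b) ∪ sing x))

      module _ {B : Subset E} {b : E} (bB : IsBase M B) (Bb : B b) where

        fundamentalCocircuit-isCocircuit : IsCocircuit M (fundamentalCocircuit B b)
        fundamentalCocircuit-isCocircuit = proj₁ , dependent , minimal
          where
          iB = proj₁ bB
          U = fundamentalCocircuit B b
          dependent : ¬ indep (dual M) U
          dependent (_ , D , bD , U∩D) =
            let (x , Dx , ¬x∈B-b , iB-b+x) =
                  I3 (B ─ b) D (indep-mono iB proj₁) (base-minus-¬isBase iB Bb) bD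
            in U∩D x (indep⊆ground _ (proj₁ bD) Dx , ¬x∈B-b , fromWitness iB-b+x) Dx
          minimal : ∀ (U′ : Subset E) → U′ ⊆ U → ¬ indep (dual M) U′ → U ⊆ U′
          minimal U′ U′⊆U ¬iU′ {u} (gu , ¬u∈B-b , iB-b+u) = dne λ ¬U′u →
            let S⊆g : ((ground M ∩ ∁ U) ∪ sing u) ⊆ ground M
                S⊆g = λ { (inj₁ p) → proj₁ p ; (inj₂ refl) → gu }
                (D , B-b+u⊆D , (iD , D⊆S , _)) = basis-extend (toWitness iB-b+u)
                  (λ { (inj₁ p) → inj₁ (indep⊆ground _ iB (proj₁ p) , λ Up → proj₁ (proj₂ Up) p)
                     ; (inj₂ q) → inj₂ q }) S⊆g
                bD = indep-⊇exchange-isBase bB iD (λ p → B-b+u⊆D (inj₁ p)) (B-b+u⊆D (inj₂ refl)) ¬u∈B-b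
                U′∩D : Disj U′ D
                U′∩D = λ y U′y Dy → case D⊆S Dy of λ
                  { (inj₁ (_ , ¬Uy)) → ¬Uy (U′⊆U U′y)
                  ; (inj₂ y≡u) → ¬U′u (subst U′ y≡u U′y) }
            in ¬iU′ ((λ p → proj₁ (U′⊆U p)) , D , bD , U′∩D)

        fundamentalCocircuit-∋ : fundamentalCocircuit B b b
        fundamentalCocircuit-∋ = indep⊆ground _ iB Bb , (λ p → proj₂ p refl) ,
          fromWitness (indep-mono iB λ { (inj₁ p) → proj₁ p ; (inj₂ refl) → Bb })
          where iB = proj₁ bB

        fundamentalCocircuit-∩base : ∀ {x} → B x → fundamentalCocircuit B b x → x ≡ b
        fundamentalCocircuit-∩base Bx (_ , ¬x∈B-b , _) = dne λ x≢b → ¬x∈B-b (Bx , x≢b)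

      -- Extend C − x to a basis J of the complement of U. If J were also a basis of
      -- (complement of U) + x it would be a base avoiding U; otherwise it can be
      -- augmented from a base avoiding U − x, and either augmentation contradicts
      -- the dependence of C or the maximality of J.
      circuit-∩-cocircuit-≢-singleton : {C U : Subset E} {x : E} → IsCircuit M C → IsCocircuit M U →
        C x → U x → ¬ (∀ {y} → C y → U y → y ≡ x)
      circuit-∩-cocircuit-≢-singleton {C} {U} {x} cC@(C⊆g , ¬iC , _) cU@(U⊆g , ¬iU , _) Cx Ux only =
        let (_ , D , bD , U-x∩D) = circuit-minus-indep cU Ux
            (J , C-x⊆J , bJ@(iJ , J⊆S , maximalJ)) =
              basis-extend (circuit-minus-indep cC Cx)
                (λ p → C⊆g (proj₁ p) , λ Uc → proj₂ p (only (proj₁ p) Uc)) proj₁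
            Y⊆g : ((ground M ∩ ∁ U) ∪ sing x) ⊆ ground M
            Y⊆g = λ { (inj₁ p) → proj₁ p ; (inj₂ refl) → C⊆g Cx }
            D⊆Y : D ⊆ (ground M ∩ ∁ U) ∪ sing x
            D⊆Y = λ {d} Dd → case em {U d} of λ
              { (yes Ud) → case em {d ≡ x} of λ
                  { (yes d≡x) → inj₂ d≡x
                  ; (no d≢x) → ⊥-elim (U-x∩D d (Ud , d≢x) Dd) }
              ; (no ¬Ud) → inj₁ (indep⊆ground _ (proj₁ bD) Dd , ¬Ud) }
            basisD : IsBasis M ((ground M ∩ ∁ U) ∪ sing x) D
            basisD = proj₁ bD , D⊆Y , λ K iK D⊆K _ → proj₂ bD K iK D⊆K
        in case em₁ {IsBasis M ((ground M ∩ ∁ U) ∪ sing x) J} of λ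
          { (yes basisJ) → ¬iU (U⊆g , J , basis-of-⊇base-isBase bD D⊆Y basisJ ,
                                λ _ Ue Je → proj₂ (J⊆S Je) Ue)
          ; (no ¬basisJ) →
              let (y , Dy , ¬Jy , iJy) = basis-augment Y⊆g basisD iJ (λ p → inj₁ (J⊆S p)) ¬basisJ
              in case D⊆Y Dy of λ
                { (inj₁ Sy) → ¬Jy (maximalJ (J ∪ sing y) iJy inj₁
                     (λ { (inj₁ p) → J⊆S p ; (inj₂ refl) → Sy }) (inj₂ refl))
                ; (inj₂ y≡x) → ¬iC (indep-mono iJy λ {c} Cc → case em {c ≡ x} of λ
                     { (yes c≡x) → inj₂ (trans c≡x (sym y≡x))
                     ; (no c≢x) → inj₁ (C-x⊆J (Cc , c≢x)) }) } }

      cocircuit-through-pair : {D : Subset E} {e f : E} → IsCircuit M D → D e → D f → ¬ e ≡ f →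
        Σ (Subset E) λ U → IsCocircuit M U × U e × U f × (∀ {x} → D x → U x → x ≡ e ⊎ x ≡ f)
      cocircuit-through-pair {D} {e} {f} cD De Df e≢f =
        let (B , bB , D-e⊆B) = base-extend (circuit-minus-indep cD De)
            Bf = D-e⊆B (Df , λ f≡e → e≢f (sym f≡e))
            U = fundamentalCocircuit B f
            cU = fundamentalCocircuit-isCocircuit bB Bf
            D∩U⊆f : ∀ {x} → D x → U x → ¬ x ≡ e → x ≡ f
            D∩U⊆f Dx Ux x≢e = fundamentalCocircuit-∩base bB Bf (D-e⊆B (Dx , x≢e)) Ux
            only : ∀ {x} → D x → U x → x ≡ e ⊎ x ≡ f
            only {x} Dx Ux = case em {x ≡ e} of λ
              { (yes x≡e) → inj₁ x≡e ; (no x≢e) → inj₂ (D∩U⊆f Dx Ux x≢e) }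
            Ue : U e
            Ue = dne λ ¬Ue → circuit-∩-cocircuit-≢-singleton cD cU Df (fundamentalCocircuit-∋ bB Bf)
              λ {y} Dy Uy → D∩U⊆f Dy Uy λ { refl → ¬Ue Uy }
        in U , cU , Ue , fundamentalCocircuit-∋ bB Bf , only

      circuit-nonempty : {D : Subset E} → IsCircuit M D → ∃ D
      circuit-nonempty (_ , ¬iD , _) = dne λ ∄ → ¬iD (indep-mono I1 λ {x} Dx → ∄ (x , Dx))

      isCircuit-resp-≐ : {D D′ : Subset E} → D ≐ D′ → IsCircuit M D → IsCircuit M D′
      isCircuit-resp-≐ (D⊆D′ , D′⊆D) (D⊆g , ¬iD , minimal) =
        (λ p → D⊆g (D′⊆D p)) , (λ iD′ → ¬iD (indep-mono iD′ D⊆D′)) ,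
        λ D″ D″⊆D′ ¬iD″ p → minimal D″ (λ q → D′⊆D (D″⊆D′ q)) ¬iD″ (D′⊆D p)

      delete-isMatroid : (G : Subset E) → IsMatroid (M ∖ₘ G)
      delete-isMatroid G = record
        { indep⊆ground = λ I (iI , I∩G) p → indep⊆ground I iI p , I∩G p
        ; I1 = I1 , λ ()
        ; I2 = λ I J (iJ , J∩G) I⊆J → indep-mono iJ I⊆J , λ p → J∩G (I⊆J p)
        ; I3 = λ I I′ iI ¬base bI′ →
            let ((iI′ , I′∩G) , maximalI′) = bI′
                I⊆X : I ⊆ ground M ∩ ∁ G
                I⊆X = λ p → indep⊆ground _ (proj₁ iI) p , proj₂ iI p
                basisI′ : IsBasis M (ground M ∩ ∁ G) I′
                basisI′ = iI′ , (λ p → indep⊆ground _ iI′ p , I′∩G p) ,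
                  λ K iK I′⊆K K⊆X → maximalI′ K (iK , λ p → proj₂ (K⊆X p)) I′⊆K
                ¬basisI : ¬ IsBasis M (ground M ∩ ∁ G) I
                ¬basisI (_ , _ , maximal) = ¬base (iI , λ K iK I⊆K →
                  maximal K (proj₁ iK) I⊆K λ p → indep⊆ground K (proj₁ iK) p , proj₂ iK p)
                (x , I′x , ¬Ix , iIx) = basis-augment proj₁ basisI′ (proj₁ iI) I⊆X ¬basisI
            in x , I′x , ¬Ix , iIx , λ { (inj₁ p) → proj₂ iI p ; (inj₂ refl) → I′∩G I′x }
        ; IM = λ I X iI I⊆X X⊆g →
            let (J , (iJ , I⊆J , J⊆X) , maximal) = IM I X (proj₁ iI) I⊆X (λ p → proj₁ (X⊆g p))
            in J , ((iJ , λ p → proj₂ (X⊆g (J⊆X p))) , I⊆J , J⊆X) ,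
               λ K iK → maximal K (proj₁ iK)
        }

      coindep-isDualBase : {I D : Subset E} → indep (dual M) I → IsBase M D →
                           ground M ∩ ∁ I ⊆ D → IsBase (dual M) I
      coindep-isDualBase {I} {D} iI bD compl⊆D = iI , λ K (K⊆g , D′ , bD′ , K∩D′) I⊆K {k} Kk →
        dne λ ¬Ik →
          let D′⊆D : D′ ⊆ D
              D′⊆D = λ {d} D′d → compl⊆D (indep⊆ground _ (proj₁ bD′) D′d ,
                                          λ Id → K∩D′ d (I⊆K Id) D′d)
          in K∩D′ k Kk (proj₂ bD′ D (proj₁ bD) D′⊆D (compl⊆D (K⊆g Kk , ¬Ik)))

      coindep-maximal-outside-base : {X Z P D : Subset E} → Disj Z X →
        (∀ {x} → ground M x → ¬ X x → Z x) → IsBasis M Z P → IsBase M D → P ⊆ D →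
        ∀ (K : Subset E) → indep (dual M) K → K ⊆ X → X ∩ ∁ D ⊆ K → K ⊆ X ∩ ∁ D
      coindep-maximal-outside-base {X} {Z} {P} {D} Z∩X cover (iP , P⊆Z , maximalP) bD P⊆D
                                   K (_ , D′ , bD′ , K∩D′) K⊆X X∖D⊆K {k} Kk = K⊆X Kk , λ Dk →
        let iD = proj₁ bD
            (x , D′x , ¬x∈D-k , iD-k+x) =
              I3 (D ─ k) D′ (indep-mono iD proj₁) (base-minus-¬isBase iD Dk) bD′
            ¬Dx : ¬ D x
            ¬Dx Dx = ¬x∈D-k (Dx , λ x≡k → K∩D′ k Kk (subst D′ x≡k D′x))
        in case em {X x} of λ
          { (yes Xx) → K∩D′ x (X∖D⊆K (Xx , ¬Dx)) D′x
          ; (no ¬Xx) → ¬Dx (P⊆D (maximalP (P ∪ sing x)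
              (indep-mono iD-k+x λ
                { (inj₁ Pp) → inj₁ (P⊆D Pp , λ { refl → Z∩X _ (P⊆Z Pp) (K⊆X Kk) })
                ; (inj₂ q) → inj₂ q })
              inj₁ (λ { (inj₁ p) → P⊆Z p ; (inj₂ refl) → cover (indep⊆ground _ (proj₁ bD′) D′x) ¬Xx })
              (inj₂ refl))) }

      dual-isMatroid : IsMatroid (dual M)
      dual-isMatroid = record
        { indep⊆ground = λ _ → proj₁
        ; I1 = let (B , bB , _) = base-extend I1 in (λ ()) , B , bB , λ _ ()
        ; I2 = λ { I J (J⊆g , B , bB , J∩B) I⊆J → (λ p → J⊆g (I⊆J p)) , B , bB , λ e p → J∩B e (I⊆J p) }
        ; I3 = dual-augment
        ; IM = dual-maximal
        }
        where
        dual-augment : ∀ (I I′ : Subset E) → indep (dual M) I → ¬ IsBase (dual M) I → IsBase (dual M) I′ →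
                       ∃ λ x → I′ x × ¬ I x × indep (dual M) (I ∪ sing x)
        dual-augment I I′ iI@(I⊆g , B , bB , I∩B) ¬base bI′ =
          let (B′ , bB′ , _ , compl⊆I′) = dualBase-complement bI′
              (D , B′∖I⊆D , basisD@(_ , D⊆Y , _)) = basis-extend {I = B′ ∩ ∁ I} {X = ground M ∩ ∁ I}
                (indep-mono (proj₁ bB′) proj₁) (λ p → indep⊆ground _ (proj₁ bB′) (proj₁ p) , proj₂ p) proj₁
              bD = basis-of-⊇base-isBase bB (λ Bb → indep⊆ground _ (proj₁ bB) Bb , λ Ib → I∩B _ Ib Bb) basisD
              (x , (gx , ¬Ix) , ¬Dx , ¬B′x) = dne {∃ λ x → (ground M ∩ ∁ I) x × ¬ D x × ¬ B′ x} λ ∄ →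
                ¬base (coindep-isDualBase iI bD λ {y} Yy → dne λ ¬Dy → case em {B′ y} of λ
                  { (yes B′y) → ¬Dy (B′∖I⊆D (B′y , proj₂ Yy))
                  ; (no ¬B′y) → ∄ (y , Yy , ¬Dy , ¬B′y) })
          in x , compl⊆I′ (gx , ¬B′x) , ¬Ix ,
             (λ { (inj₁ p) → I⊆g p ; (inj₂ refl) → gx }) , D , bD ,
             λ { e (inj₁ Ie) De → proj₂ (D⊆Y De) Ie ; e (inj₂ refl) De → ¬Dx De }
        dual-maximal : ∀ (I X : Subset E) → indep (dual M) I → I ⊆ X → X ⊆ ground M →
          Σ (Subset E) λ J → (indep (dual M) J × I ⊆ J × J ⊆ X) ×
            (∀ (K : Subset E) → indep (dual M) K → I ⊆ K → K ⊆ X → J ⊆ K → K ⊆ J)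
        dual-maximal I X (_ , B , bB , I∩B) I⊆X X⊆g =
          let (P , basisP@(iP , P⊆Z , _)) = basis-of-∅ {X = ground M ∩ ∁ X} proj₁
              (D , P⊆D , basisD) = basis-extend iP inj₁
                λ { (inj₁ p) → proj₁ (P⊆Z p) ; (inj₂ p) → indep⊆ground _ (proj₁ bB) p }
              bD = basis-of-⊇base-isBase bB inj₂ basisD
              I⊆X∖D : I ⊆ X ∩ ∁ D
              I⊆X∖D = λ {i} Ii → I⊆X Ii , λ Di → case proj₁ (proj₂ basisD) Di of λ
                { (inj₁ Pi) → proj₂ (P⊆Z Pi) (I⊆X Ii)
                ; (inj₂ Bi) → I∩B i Ii Bi }
          in X ∩ ∁ D , (((λ p → X⊆g (proj₁ p)) , D , bD , λ _ p → proj₂ p) , I⊆X∖D , proj₁) ,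
             λ K iK _ → coindep-maximal-outside-base (λ _ p → proj₂ p) (λ gx ¬Xx → gx , ¬Xx)
                          basisP bD P⊆D K iK

      outside-base-coindep : {F D : Subset E} → IsBase M D →
                             indep (dual M ∖ₘ F) ((ground M ∩ ∁ F) ∩ ∁ D)
      outside-base-coindep {D = D} bD = ((λ p → proj₁ (proj₁ p)) , D , bD , λ _ p → proj₂ p) ,
                                       λ p → proj₂ (proj₁ p)

      module _ {F BF : Subset E} (F⊆g : F ⊆ ground M) (basisBF : IsBasis M F BF) where

        contract-indep⇐ : {I : Subset E} → I ⊆ ground M ∩ ∁ F → indep M (I ∪ BF) →
                          indep (M /ₘ F) I
        contract-indep⇐ {I} I⊆X iIBF =
          let (D , bD , IBF⊆D) = base-extend iIBF
          in I⊆X , (ground M ∩ ∁ F) ∩ ∁ D ,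
             (outside-base-coindep bD ,
              λ K ((K⊆g , K-coindep) , K∩F) → coindep-maximal-outside-base
                (λ _ Fx Xx → proj₂ Xx Fx) (λ gx ¬Xx → dne λ ¬Fx → ¬Xx (gx , ¬Fx))
                basisBF bD (λ p → IBF⊆D (inj₂ p)) K (K⊆g , K-coindep) (λ p → K⊆g p , K∩F p)) ,
             λ _ Ie q → proj₂ q (IBF⊆D (inj₁ Ie))

        -- Basis exchange inside D + x would produce a base D″ whose complement
        -- still contains B*, and maximality of B* then forces an element of D into B*.
        base-∩-isBasis : {D B* : Subset E} → IsBase M D → IsBase (dual M ∖ₘ F) B* →
                         Disj B* D → IsBasis M F (D ∩ F)
        base-∩-isBasis {D} {B*} bD (((B*⊆g , _) , B*∩F) , maximalB*) B*∩D = dne₁ λ ¬basis →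
          let iD = proj₁ bD
              (x , BFx , ¬x∈D∩F , iD∩F+x) =
                basis-augment F⊆g basisBF (indep-mono iD proj₁) proj₂ ¬basis
              Fx = proj₁ (proj₂ basisBF) BFx
              ¬Dx : ¬ D x
              ¬Dx Dx = ¬x∈D∩F (Dx , Fx)
              (D″ , D∩F+x⊆D″ , basisD″@(iD″ , D″⊆D+x , _)) = basis-extend iD∩F+x
                (λ { (inj₁ p) → inj₁ (proj₁ p) ; (inj₂ q) → inj₂ q })
                (λ { (inj₁ p) → indep⊆ground _ iD p ; (inj₂ refl) → F⊆g Fx })
              (q , D+x∋q , ¬D″q) = ⊈⇒∃ {A = D ∪ sing x} {B = D″} λ D+x⊆D″ →
                ¬Dx (proj₂ bD _ (indep-mono iD″ D+x⊆D″) inj₁ (inj₂ refl))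
              Dq : D q
              Dq = case D+x∋q of λ
                { (inj₁ p) → p
                ; (inj₂ q≡x) → ⊥-elim (¬D″q (subst D″ (sym q≡x) (D∩F+x⊆D″ (inj₂ refl)))) }
              ¬Fq : ¬ F q
              ¬Fq Fq = ¬D″q (D∩F+x⊆D″ (inj₁ (Dq , Fq)))
              B*⊆X∖D″ : B* ⊆ (ground M ∩ ∁ F) ∩ ∁ D″
              B*⊆X∖D″ {b} B*b = (B*⊆g B*b , B*∩F B*b) , λ D″b → case D″⊆D+x D″b of λ
                { (inj₁ Db) → B*∩D b B*b Db
                ; (inj₂ b≡x) → B*∩F B*b (subst F (sym b≡x) Fx) }
              bD″ = basis-of-⊇base-isBase bD inj₁ basisD″
          in B*∩D q (maximalB* _ (outside-base-coindep bD″) B*⊆X∖D″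
                       ((indep⊆ground _ iD Dq , ¬Fq) , ¬D″q)) Dq

        contract-indep⇒ : {I : Subset E} → indep (M /ₘ F) I →
                          I ⊆ ground M ∩ ∁ F × indep M (I ∪ BF)
        contract-indep⇒ {I} (I⊆X , B* , bB*@(((B*⊆g , D , bD , B*∩D) , B*∩F) , maximalB*) , I∩B*) =
          let X∖D⊆B* = maximalB* _ (outside-base-coindep bD)
                         (λ p → (B*⊆g p , B*∩F p) , λ Dq → B*∩D _ p Dq)
              I⊆D : I ⊆ D
              I⊆D = λ {i} Ii → dne λ ¬Di → I∩B* i Ii (X∖D⊆B* (I⊆X Ii , ¬Di))
          in I⊆X , ∪-basis-indep-swap F⊆g (base-∩-isBasis bD bB* B*∩D) basisBF
                     (λ i Ii Fi → proj₂ (I⊆X Ii) Fi)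
                     (indep-mono (proj₁ bD) λ { (inj₁ p) → I⊆D p ; (inj₂ q) → proj₁ q })

      dual-involutive : dual (dual M) ≅ M
      dual-involutive = ≐-refl ,
        (λ { I (I⊆g , B* , bB* , I∩B*) →
               let (B , bB , _ , compl⊆B*) = dualBase-complement bB*
               in indep-mono (proj₁ bB) λ {i} Ii → dne λ ¬Bi → I∩B* i Ii (compl⊆B* (I⊆g Ii , ¬Bi)) }) ,
        λ I iI → let (B , bB , I⊆B) = base-extend iI
                 in indep⊆ground I iI , ground M ∩ ∁ B , complement-isDualBase bB ,
                    λ _ Ie q → proj₂ q (I⊆B Ie)

    open MatroidLemmas using (delete-isMatroid; dual-isMatroid; dual-involutive; isCircuit-resp-≐; circuit-nonempty; cocircuit-through-pair)

    minor-isMatroid : {M : MatroidData E} → IsMatroid M → (F G : Subset E) → IsMatroid (minor M F G)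
    minor-isMatroid mat F G = delete-isMatroid (dual-isMatroid (delete-isMatroid (dual-isMatroid mat) F)) G

    delete-contract-comm : {M : MatroidData E} → IsMatroid M → {F G : Subset E} → G ⊆ ground M →
                           Disj G F → (M ∖ₘ F) /ₘ G ≅ (M /ₘ G) ∖ₘ F
    delete-contract-comm {M} mat {F} {G} G⊆g G∩F =
      ((λ { ((gx , ¬Fx) , ¬Gx) → (gx , ¬Gx) , ¬Fx }) , (λ { ((gx , ¬Gx) , ¬Fx) → (gx , ¬Fx) , ¬Gx })) ,
      (λ I iI → let (I⊆X , iIBG , _) = M∖F.contract-indep⇒ G⊆g′ basisBG′ iI
                in M.contract-indep⇐ G⊆g basisBG (λ p → proj₁ (proj₁ (I⊆X p)) , proj₂ (I⊆X p)) iIBG ,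
                   λ p → proj₂ (proj₁ (I⊆X p))) ,
      (λ { I (iI , I∩F) → let (I⊆X , iIBG) = M.contract-indep⇒ G⊆g basisBG iI
                          in M∖F.contract-indep⇐ G⊆g′ basisBG′ (λ p → (proj₁ (I⊆X p) , I∩F p) , proj₂ (I⊆X p))
                               (iIBG , λ { (inj₁ p) → I∩F p ; (inj₂ b) → G∩F _ (proj₁ (proj₂ basisBG) b) }) })
      where
      module M = MatroidLemmas mat
      module M∖F = MatroidLemmas (delete-isMatroid mat F)
      G⊆g′ : G ⊆ ground (M ∖ₘ F)
      G⊆g′ p = G⊆g p , λ Fx → G∩F _ p Fx
      BG = proj₁ (M.basis-of-∅ G⊆g)
      basisBG : IsBasis M G BG
      basisBG = proj₂ (M.basis-of-∅ G⊆g)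
      basisBG′ : IsBasis (M ∖ₘ F) G BG
      basisBG′ = let (iBG , BG⊆G , maximal) = basisBG
                 in (iBG , λ b → G∩F _ (BG⊆G b)) , BG⊆G , λ K iK → maximal K (proj₁ iK)

    minor-dual : {M : MatroidData E} → IsMatroid M → {F G : Subset E} → G ⊆ ground M →
                 Disj G F → dual (minor M F G) ≅ minor (dual M) G F
    minor-dual mat = delete-contract-comm (dual-isMatroid mat)

    -- Opaque because only the stated properties of the lift are ever used, and
    -- unfolding its witness in conversion checks is prohibitively slow.
    opaque
      -- D′ − e together with a basis of F is independent in M while adding e is not,
      -- so the fundamental circuit of e lifts D′.
      minor-circuit-lift : {M : MatroidData E} → IsMatroid M → {F G D′ : Subset E} → F ⊆ ground M →
        IsCircuit (minor M F G) D′ → Σ (Subset E) λ D → IsCircuit M D × LiftOf F D′ D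
      minor-circuit-lift {M} mat {F} {G} {D′} F⊆g cD′@(D′⊆g , ¬iD′ , _) =
        fundamentalCircuit T e , fundamentalCircuit-isCircuit iT ¬Te (proj₁ (D′⊆X D′e)) ¬iT+e ,
        D′⊆D , D⊆D′∪F
        where
        open MatroidLemmas mat hiding (circuit-nonempty)
        BF : Subset E
        BF = proj₁ (basis-of-∅ F⊆g)
        basisBF : IsBasis M F BF
        basisBF = proj₂ (basis-of-∅ F⊆g)
        nonempty : ∃ D′
        nonempty = circuit-nonempty (minor-isMatroid mat F G) cD′
        e : E
        e = proj₁ nonempty
        D′e : D′ e
        D′e = proj₂ nonempty
        T : Subset E
        T = (D′ ─ e) ∪ BF
        D′⊆X : D′ ⊆ ground M ∩ ∁ F
        D′⊆X p = proj₁ (D′⊆g p)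
        D′-d∪BF-indep : ∀ {d} → D′ d → indep M ((D′ ─ d) ∪ BF)
        D′-d∪BF-indep D′d = proj₂ (contract-indep⇒ F⊆g basisBF (proj₁ (circuit-minus-indep cD′ D′d)))
        iT : indep M T
        iT = D′-d∪BF-indep D′e
        ¬iT+e : ¬ indep M (T ∪ sing e)
        ¬iT+e iT+e = ¬iD′ (contract-indep⇐ F⊆g basisBF D′⊆X (indep-mono iT+e λ {d} → λ
          { (inj₁ D′d) → case em {d ≡ e} of λ
              { (yes d≡e) → inj₂ d≡e ; (no d≢e) → inj₁ (inj₁ (D′d , d≢e)) }
          ; (inj₂ b) → inj₁ (inj₂ b) }) , λ p → proj₂ (D′⊆g p))
        ¬Te : ¬ T e
        ¬Te (inj₁ (_ , e≢e)) = e≢e refl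
        ¬Te (inj₂ b) = proj₂ (D′⊆X D′e) (proj₁ (proj₂ basisBF) b)
        D′⊆D : D′ ⊆ fundamentalCircuit T e
        D′⊆D {d} D′d = case em {d ≡ e} of λ
          { (yes d≡e) → inj₁ d≡e
          ; (no d≢e) → inj₂ (inj₁ (D′d , d≢e) , fromWitness (indep-mono (D′-d∪BF-indep D′d) λ
              { (inj₁ (inj₁ (p , _) , p≢d)) → inj₁ (p , p≢d)
              ; (inj₁ (inj₂ b , _)) → inj₂ b
              ; (inj₂ refl) → inj₁ (D′e , λ e≡d → d≢e (sym e≡d)) })) }
        D⊆D′∪F : fundamentalCircuit T e ⊆ D′ ∪ F
        D⊆D′∪F (inj₁ refl) = inj₁ D′e
        D⊆D′∪F (inj₂ (inj₁ (p , _) , _)) = inj₁ p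
        D⊆D′∪F (inj₂ (inj₂ b , _)) = inj₂ (proj₁ (proj₂ basisBF) b)

    minor-cocircuit-lift : {M : MatroidData E} → IsMatroid M → {F G U′ : Subset E} → G ⊆ ground M →
      Disj G F → IsCocircuit (minor M F G) U′ → Σ (Subset E) λ U → IsCocircuit M U × LiftOf G U′ U
    minor-cocircuit-lift mat G⊆g G∩F cU′ =
      minor-circuit-lift (dual-isMatroid mat) G⊆g (≅-isCircuit (minor-dual mat G⊆g G∩F) cU′)

    dual-orthOriented : {M : MatroidData E} {𝒞 𝒞* : SignedFamily E} →
      IsOrthOrientedMatroid M 𝒞 𝒞* → IsOrthOrientedMatroid (dual M) 𝒞* 𝒞
    dual-orthOriented oom = record
      { matroid = dual-isMatroid matroid
      ; circSig = cocircSig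
      ; cocircSig = signature-transport (≅-sym (dual-involutive matroid)) (≐-refl) circSig
      ; orth = λ U C 𝒞*U 𝒞C → Orthogonal-sym C U (orth C U 𝒞C 𝒞*U)
      }
      where open IsOrthOrientedMatroid oom

    module InducedSignature {M : MatroidData E} {𝒞 𝒞* : SignedFamily E}
                            (oom : IsOrthOrientedMatroid M 𝒞 𝒞*) {F G : Subset E}
                            (F⊆g : F ⊆ ground M) (G⊆g : G ⊆ ground M) (F∩G : Disj F G) where
      open IsOrthOrientedMatroid oom

      N : MatroidData E
      N = minor M F G

      N-isMatroid : IsMatroid N
      N-isMatroid = minor-isMatroid matroid F G

      circuit⊆∁G : {D′ : Subset E} → IsCircuit N D′ → D′ ⊆ ∁ G
      circuit⊆∁G (D′⊆g , _) p = proj₂ (D′⊆g p)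

      cocircuit⊆∁F : {U′ : Subset E} → IsCocircuit N U′ → U′ ⊆ ∁ F
      cocircuit⊆∁F (U′⊆g , _) p = proj₂ (proj₁ (U′⊆g p))

      -- Orthogonality to W forces opposite sign flips between e and f on every lift of D′,
      -- so the relative sign of two lifts is the same at e and at f.
      SameSign-transfer : {D′ U′ : Subset E} {e f : E} → IsCircuit N D′ → IsCocircuit N U′ →
        (∀ {x} → D′ x → U′ x → x ≡ e ⊎ x ≡ f) → D′ e → U′ e →
        (W : Signed E) → 𝒞* W → 𝒞* (opp W) → LiftOf G U′ (supp W) →
        (C₁ C₂ : Signed E) → 𝒞 C₁ → 𝒞 C₂ → LiftOf F D′ (supp C₁) → LiftOf F D′ (supp C₂) →
        SameSign C₁ C₂ e → SameSign C₁ C₂ f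
      SameSign-transfer {D′} {U′} {e} {f} cD′ cU′ D′∩U′⊆ef D′e U′e W 𝒞*W 𝒞*W⁻ liftW
                        C₁ C₂ 𝒞C₁ 𝒞C₂ lift₁ lift₂ same =
        case sign-cases C₁ W (proj₁ lift₁ D′e) (proj₁ liftW U′e) of λ
          { (inj₁ s₁) →
              let s₂ = SameSign-trans C₂ C₁ W (SameSign-sym C₁ C₂ same) s₁
              in SameSign-via C₁ C₂ (opp W) (flip C₁ W 𝒞C₁ lift₁ 𝒞*W liftW s₁)
                                            (flip C₂ W 𝒞C₂ lift₂ 𝒞*W liftW s₂)
          ; (inj₂ o₁) →
              let o₂ = SameSign-trans C₂ C₁ (opp W) (SameSign-sym C₁ C₂ same) o₁
              in SameSign-via C₁ C₂ W (flip C₁ (opp W) 𝒞C₁ lift₁ 𝒞*W⁻ liftW⁻ o₁)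
                                      (flip C₂ (opp W) 𝒞C₂ lift₂ 𝒞*W⁻ liftW⁻ o₂) }
        where
        liftW⁻ : LiftOf G U′ (supp (opp W))
        liftW⁻ = LiftOf-opp W liftW
        flip : ∀ C V → 𝒞 C → LiftOf F D′ (supp C) → 𝒞* V → LiftOf G U′ (supp V) →
               SameSign C V e → OppSign C V f
        flip C V 𝒞C liftC 𝒞*V liftV = orthogonal-flip C V (orth C V 𝒞C 𝒞*V) λ Cx Vx →
          Product.uncurry D′∩U′⊆ef
            (lifts-meet-inside F∩G (circuit⊆∁G cD′) (cocircuit⊆∁F cU′) liftC liftV Cx Vx)

      lift-SameSign-constant : {D′ : Subset E} → IsCircuit N D′ → (C₁ C₂ : Signed E) → 𝒞 C₁ → 𝒞 C₂ →
        LiftOf F D′ (supp C₁) → LiftOf F D′ (supp C₂) → {e f : E} → D′ e → D′ f →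
        SameSign C₁ C₂ e → SameSign C₁ C₂ f
      lift-SameSign-constant cD′ C₁ C₂ 𝒞C₁ 𝒞C₂ lift₁ lift₂ {e} {f} D′e D′f = case em {e ≡ f} of λ
        { (yes e≡f) → subst (SameSign C₁ C₂) e≡f
        ; (no e≢f) →
            let (U′ , cU′ , U′e , _ , D′∩U′⊆ef) = cocircuit-through-pair N-isMatroid cD′ D′e D′f e≢f
                (U , cU , U′⊆U , U⊆U′∪G) = minor-cocircuit-lift matroid G⊆g (λ x g f → F∩G x f g) cU′
                (W , (W⊆U , U⊆W) , 𝒞*W , 𝒞*W⁻ , _) = proj₂ cocircSig U cU
            in SameSign-transfer cD′ cU′ D′∩U′⊆ef D′e U′e W 𝒞*W 𝒞*W⁻
                 ((λ p → U⊆W (U′⊆U p)) , (λ p → U⊆U′∪G (W⊆U p))) C₁ C₂ 𝒞C₁ 𝒞C₂ lift₁ lift₂ }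

      lifts-agree-or-oppose : {D′ : Subset E} → IsCircuit N D′ → (C₁ C₂ : Signed E) → 𝒞 C₁ → 𝒞 C₂ →
        LiftOf F D′ (supp C₁) → LiftOf F D′ (supp C₂) →
        (∀ {x} → D′ x → SameSign C₁ C₂ x) ⊎ (∀ {x} → D′ x → OppSign C₁ C₂ x)
      lifts-agree-or-oppose cD′ C₁ C₂ 𝒞C₁ 𝒞C₂ lift₁ lift₂ =
        case sign-cases C₁ C₂ (proj₁ lift₁ D′e) (proj₁ lift₂ D′e) of λ
          { (inj₁ same) → inj₁ λ {x} D′x → constant D′e D′x same
          ; (inj₂ opposite) → inj₂ λ {x} D′x → case sign-cases C₁ C₂ (proj₁ lift₁ D′x) (proj₁ lift₂ D′x) of λ
              { (inj₁ same) → ⊥-elim (SameSign⇒¬OppSign C₁ C₂ (constant D′x D′e same) opposite)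
              ; (inj₂ opposite′) → opposite′ } }
        where
        constant = lift-SameSign-constant cD′ C₁ C₂ 𝒞C₁ 𝒞C₂ lift₁ lift₂
        D′e = proj₂ (circuit-nonempty N-isMatroid cD′)

      signed-circuit-lift : {D′ : Subset E} → IsCircuit N D′ →
        Σ (Signed E) λ C → 𝒞 C × 𝒞 (opp C) × LiftOf F D′ (supp C)
      signed-circuit-lift cD′ =
        let (D , cD , D′⊆D , D⊆D′∪F) = minor-circuit-lift matroid F⊆g cD′
            (C , (C⊆D , D⊆C) , 𝒞C , 𝒞C⁻ , _) = proj₂ circSig D cD
        in C , 𝒞C , 𝒞C⁻ , (λ p → D⊆C (D′⊆D p)) , λ p → D⊆D′∪F (C⊆D p)

      induced-circuitSignature : IsCircuitSignature N (inducedCircuits M 𝒞 F G)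
      induced-circuitSignature = supports , signings
        where
        supports : ∀ (Y : Signed E) → inducedCircuits M 𝒞 F G Y → IsCircuit N (supp Y)
        supports Y (D′ , cD′ , C , _ , D′⊆C , _ , Y≈) = isCircuit-resp-≐ N-isMatroid
          (≐-sym (≐-trans (supp-resp-≈ₛ Y (restrict C D′) Y≈) (supp-restrict C D′⊆C))) cD′
        signings : ∀ (D′ : Subset E) → IsCircuit N D′ →
          Σ (Signed E) λ C′ → supp C′ ≐ D′ × inducedCircuits M 𝒞 F G C′ × inducedCircuits M 𝒞 F G (opp C′) ×
            (∀ (Y : Signed E) → inducedCircuits M 𝒞 F G Y → supp Y ≐ D′ → Y ≈ₛ C′ ⊎ Y ≈ₛ opp C′)
        signings D′ cD′ with signed-circuit-lift cD′
        ... | C , 𝒞C , 𝒞C⁻ , liftC =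
          restrict C D′ , supp-restrict C (proj₁ liftC) ,
          (D′ , cD′ , C , 𝒞C , proj₁ liftC , proj₂ liftC , ≈ₛ-refl (restrict C D′)) ,
          (D′ , cD′ , opp C , 𝒞C⁻ , proj₁ liftC⁻ , proj₂ liftC⁻ , ≈ₛ-refl (opp (restrict C D′))) ,
          unique
          where
          liftC⁻ = LiftOf-opp C liftC
          unique : ∀ (Y : Signed E) → inducedCircuits M 𝒞 F G Y → supp Y ≐ D′ →
                   Y ≈ₛ restrict C D′ ⊎ Y ≈ₛ opp (restrict C D′)
          unique Y (D₂ , _ , C₂ , 𝒞C₂ , D₂⊆C₂ , C₂⊆D₂∪F , Y≈) Y≐D′ =
            let (D₂⊆D′ , D′⊆D₂) = ≐-trans (≐-sym (≐-trans (supp-resp-≈ₛ Y (restrict C₂ D₂) Y≈) (supp-restrict C₂ D₂⊆C₂))) Y≐D′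
                liftC₂ : LiftOf F D′ (supp C₂)
                liftC₂ = (λ p → D₂⊆C₂ (D′⊆D₂ p)) , λ p → Sum.map₁ D₂⊆D′ (C₂⊆D₂∪F p)
                Y≈C₂∣D′ : Y ≈ₛ restrict C₂ D′
                Y≈C₂∣D′ = ≈ₛ-trans Y (restrict C₂ D₂) (restrict C₂ D′) Y≈ (restrict-cong C₂ (D₂⊆D′ , D′⊆D₂))
            in case lifts-agree-or-oppose cD′ C₂ C 𝒞C₂ 𝒞C liftC₂ liftC of λ
              { (inj₁ same) → inj₁ (≈ₛ-trans Y (restrict C₂ D′) (restrict C D′) Y≈C₂∣D′ (restrict-SameSign C₂ C same))
              ; (inj₂ opposite) → inj₂ (≈ₛ-trans Y (restrict C₂ D′) (opp (restrict C D′)) Y≈C₂∣D′ (restrict-OppSign C₂ C opposite)) }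

      induced-orthogonal : ∀ (Y Z : Signed E) → inducedCircuits M 𝒞 F G Y → inducedCocircuits M 𝒞* F G Z →
                           Orthogonal Y Z
      induced-orthogonal Y Z (D′ , cD′ , C , 𝒞C , D′⊆C , C⊆D′∪F , Y≈) (U′ , cU′ , W , 𝒞*W , U′⊆W , W⊆U′∪G , Z≈) =
        ≈ₛ-restrict-orthogonal Y C Z W Y≈ Z≈
          (lifts-meet-inside F∩G (circuit⊆∁G cD′) (cocircuit⊆∁F cU′) (D′⊆C , C⊆D′∪F) (U′⊆W , W⊆U′∪G))
          (orth C W 𝒞C 𝒞*W)

    induced-cocircuitSignature : {M : MatroidData E} {𝒞 𝒞* : SignedFamily E} →
      IsOrthOrientedMatroid M 𝒞 𝒞* → {F G : Subset E} → F ⊆ ground M → G ⊆ ground M → Disj F G →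
      IsCocircuitSignature (minor M F G) (inducedCocircuits M 𝒞* F G)
    induced-cocircuitSignature oom F⊆g G⊆g F∩G =
      signature-transport (≅-sym N*≅)
        ((λ (U′ , cU′ , rest) → U′ , ≅-isCircuit (≅-sym N*≅) cU′ , rest) ,
         (λ (U′ , cU′ , rest) → U′ , ≅-isCircuit N*≅ cU′ , rest))
        (InducedSignature.induced-circuitSignature (dual-orthOriented oom) G⊆g F⊆g G∩F)
      where
      G∩F : Disj _ _
      G∩F x Gx Fx = F∩G x Fx Gx
      N*≅ = minor-dual (IsOrthOrientedMatroid.matroid oom) G⊆g G∩F

theorem3p6 : ExcludedMiddle (suc 0ℓ) →
    {E : Set} (M : MatroidData E) (𝒞 𝒞* : SignedFamily E) →
    IsOrthOrientedMatroid M 𝒞 𝒞* →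
    (X F G : Subset E) → IsPartition3 (ground M) X F G →
    (ground (minor M F G) ≐ X) ×
    IsOrthOrientedMatroid (minor M F G)
      (inducedCircuits M 𝒞 F G) (inducedCocircuits M 𝒞* F G)
theorem3p6 lem M 𝒞 𝒞* oom X F G partition@((_ , XFG⊆g) , _ , _ , F∩G) =
  minor-ground M partition , record
    { matroid   = N-isMatroid
    ; circSig   = induced-circuitSignature
    ; cocircSig = induced-cocircuitSignature oom F⊆g G⊆g F∩G
    ; orth      = induced-orthogonal
    }
  where
  open Classical lem
  F⊆g : F ⊆ ground M
  F⊆g Fx = XFG⊆g (inj₁ (inj₂ Fx))
  G⊆g : G ⊆ ground M
  G⊆g Gx = XFG⊆g (inj₂ Gx)
  open InducedSignature oom F⊆g G⊆g F∩G
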